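{- Let $G=(V,E)$ be a graph on $n$ vertices. Then $p(G;i)\le p(G;i+1)$ for every integer $i$ with $1\le i<\frac{n}{2}$.
   Context: Graphs are finite and simple with nonempty vertex set. For $S\subseteq V$, color the vertices of $S$; then (domination step) every neighbor of a vertex of $S$ becomes colored; then repeatedly (forcing steps), whenever a colored vertex has exactly one uncolored neighbor, that neighbor becomes colored, until no more changes occur. $S$ is a power dominating set of $G$ if all vertices end up colored. $p(G;i)$ denotes the number of power dominating sets of $G$ of cardinality $i$. -}

module Defs where

open import Data.Nat using (ℕ; zero; suc; _≡ᵇ_)
open import Data.Bool using (Bool; true; false; _∧_; _∨_; not; if_then_else_)
open import Data.Fin using (Fin; _≟_)
open import Data.Fin.Subset using (Subset; ∣_∣)
open import Data.Vec using (Vec; []; _∷_; lookup; tabulate)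
open import Data.List using (List; []; _∷_; _++_; map; length; filterᵇ; allFin)
open import Data.Bool.ListAction using (any; all)
open import Relation.Nullary using (does)
open import Relation.Binary.PropositionalEquality using (_≡_)

record Graph (n : ℕ) : Set where
  field
    adj   : Fin n → Fin n → Bool
    sym   : ∀ u v → adj u v ≡ adj v u
    loopless : ∀ v → adj v v ≡ false

open Graph public

module _ {n : ℕ} (G : Graph n) where

  private
    mem : Fin n → Subset n → Bool
    mem v C = lookup C v

  dominate : Subset n → Subset n
  dominate S = tabulate λ v → mem v S ∨ any (λ u → mem u S ∧ adj G u v) (allFin n)

  force : Subset n → Subset n
  force C = tabulate λ v → mem v C ∨
    any (λ u → mem u C ∧ adj G u v ∧
               all (λ w → does (w ≟ v) ∨ not (adj G u w) ∨ mem w C) (allFin n))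
        (allFin n)

  iterate : ℕ → Subset n → Subset n
  iterate zero    C = C
  iterate (suc k) C = iterate k (force C)

  -- final coloured set: forcing is monotone, so after n rounds no further
  -- change can occur (each effective round colours at least one vertex)
  observed : Subset n → Subset n
  observed S = iterate n (dominate S)

  isPowerDominating : Subset n → Bool
  isPowerDominating S = all (λ v → mem v (observed S)) (allFin n)

allSubsets : (n : ℕ) → List (Subset n)
allSubsets zero    = [] ∷ []
allSubsets (suc n) = map (true ∷_) (allSubsets n) ++ map (false ∷_) (allSubsets n)

p : {n : ℕ} → Graph n → ℕ → ℕ
p {n} G i = length (filterᵇ (λ S → (∣ S ∣ ≡ᵇ i) ∧ isPowerDominating G S) (allSubsets n))

-- The argument only uses that power domination is an UPWARD-CLOSED property:
-- every superset of a power dominating set is again power dominating.  For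
-- any up-closed family F of subsets of an n-set, writing F_i for the number
-- of members of size i, the local LYM inequality
--     F_i · (n − i) ≤ F_{i+1} · (i + 1)
-- holds.  It is proved by induction on n, splitting F at the first point
-- into its link (members containing it, with the point removed) and its
-- deletion (members avoiding it); both are again up-closed, and up-closure
-- also says that the deletion is contained in the link.
--
-- The theorem follows: for 2i < n we have i + 1 ≤ n − i, so
-- F_i · (i + 1) ≤ F_{i+1} · (i + 1).
module Submission where

open import Defs using (Graph; adj; dominate; force; iterate; isPowerDominating; allSubsets; p)
open import Data.Nat using (ℕ; zero; suc; _+_; _*_; _≤_; _<_; _≡ᵇ_; z≤n)
open import Data.Nat.Properties
  using (≤-trans; *-zeroʳ; suc-injective; *-monoʳ-≤; *-cancelʳ-≤; +-mono-≤; m≤m+n; +-suc;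
         m≤n⇒∃[o]m+o≡n; module ≤-Reasoning)
open import Data.Nat.Tactic.RingSolver using (solve-∀)
open import Data.Bool using (Bool; true; false; T; _∧_; _∨_; not)
open import Data.Bool.Properties using (T-∧; T-∨; T-≡; T?)
open import Data.Bool.ListAction using (any; all)
open import Data.Fin using (Fin; _≟_)
open import Data.Fin.Subset using (Subset; _⊆_; ∣_∣)
open import Data.Fin.Subset.Properties using (⊆-refl; s⊆s; out⊆)
open import Data.Vec using (_∷_; lookup; tabulate)
open import Data.Vec.Properties using (lookup∘tabulate; []=⇒lookup; lookup⇒[]=)
open import Data.List using (List; []; _∷_; _++_; map; length; filterᵇ; allFin)
open import Data.List.Properties using (filter-++; length-++)
open import Data.List.Relation.Unary.Any as Any using ()
open import Data.List.Relation.Unary.All as All using ()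
open import Data.List.Relation.Unary.Any.Properties using (any⁺; any⁻)
open import Data.List.Relation.Unary.All.Properties using (all⁺; all⁻)
open import Data.List.Relation.Binary.Sublist.Heterogeneous.Properties
  using (length-mono-≤; ⊆-filter-Sublist)
open import Data.List.Relation.Binary.Sublist.Propositional
  using () renaming (⊆-refl to sublist-refl)
open import Data.Product as Product using (∃; _×_; _,_)
import Data.Sum as Sum
open import Function using (_∘_; id; Equivalence)
open import Relation.Nullary using (does)
open import Relation.Binary.PropositionalEquality using (_≡_; refl; sym; trans; cong; cong₂)

countᵇ : {A : Set} → (A → Bool) → List A → ℕ
countᵇ q xs = length (filterᵇ q xs)

countᵇ-++ : {A : Set} (q : A → Bool) (xs ys : List A) →
  countᵇ q (xs ++ ys) ≡ countᵇ q xs + countᵇ q ys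
countᵇ-++ q xs ys = trans (cong length (filter-++ _ xs ys)) (length-++ (filterᵇ q xs))

countᵇ-map : {A B : Set} (q : B → Bool) (g : A → B) (xs : List A) →
  countᵇ q (map g xs) ≡ countᵇ (q ∘ g) xs
countᵇ-map q g []       = refl
countᵇ-map q g (x ∷ xs) with q (g x)
... | true  = cong suc (countᵇ-map q g xs)
... | false = countᵇ-map q g xs

countᵇ-never : {A : Set} (xs : List A) → countᵇ (λ _ → false) xs ≡ 0
countᵇ-never []       = refl
countᵇ-never (_ ∷ xs) = countᵇ-never xs

countᵇ-mono : {A : Set} (q r : A → Bool) → (∀ x → T (q x) → T (r x)) →
  (xs : List A) → countᵇ q xs ≤ countᵇ r xs
countᵇ-mono q r q⇒r xs =
  length-mono-≤ (⊆-filter-Sublist (T? ∘ q) (T? ∘ r) (λ { refl → q⇒r _ }) (sublist-refl {x = xs}))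

level : {n : ℕ} → (Subset n → Bool) → ℕ → ℕ
level {n} F i = countᵇ (λ S → (∣ S ∣ ≡ᵇ i) ∧ F S) (allSubsets n)

link deletion : {m : ℕ} → (Subset (suc m) → Bool) → Subset m → Bool
link     F = F ∘ (true ∷_)
deletion F = F ∘ (false ∷_)

-- Members of size i containing the first point: the link at level i − 1.
linkLevel : {m : ℕ} → (Subset (suc m) → Bool) → ℕ → ℕ
linkLevel F zero    = 0
linkLevel F (suc i) = level (link F) i

level-split : {m : ℕ} (F : Subset (suc m) → Bool) (i : ℕ) →
  level F i ≡ linkLevel F i + level (deletion F) i
level-split {m} F i = begin
    level F i
  ≡⟨ countᵇ-++ q (map (true ∷_) (allSubsets m)) (map (false ∷_) (allSubsets m)) ⟩
    countᵇ q (map (true ∷_) (allSubsets m)) + countᵇ q (map (false ∷_) (allSubsets m))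
  ≡⟨ cong₂ _+_ (trans (countᵇ-map q (true ∷_) (allSubsets m)) (through-first i))
               (countᵇ-map q (false ∷_) (allSubsets m)) ⟩
    linkLevel F i + level (deletion F) i ∎
  where
  open Relation.Binary.PropositionalEquality.≡-Reasoning
  q : Subset (suc m) → Bool
  q S = (∣ S ∣ ≡ᵇ i) ∧ F S
  through-first : ∀ i → countᵇ (λ S → (∣ true ∷ S ∣ ≡ᵇ i) ∧ link F S) (allSubsets m)
                        ≡ linkLevel F i
  through-first zero    = countᵇ-never (allSubsets m)
  through-first (suc i) = refl

UpClosed : {n : ℕ} → (Subset n → Bool) → Set
UpClosed F = ∀ {S S′} → S ⊆ S′ → T (F S) → T (F S′)

link-upClosed : {m : ℕ} {F : Subset (suc m) → Bool} → UpClosed F → UpClosed (link F)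
link-upClosed up S⊆S′ = up (s⊆s S⊆S′)

deletion-upClosed : {m : ℕ} {F : Subset (suc m) → Bool} → UpClosed F → UpClosed (deletion F)
deletion-upClosed up S⊆S′ = up (s⊆s S⊆S′)

-- Adding the first point to a member avoiding it gives a member: the
-- deletion is contained in the link.
deletion≤link : {m : ℕ} {F : Subset (suc m) → Bool} → UpClosed F → ∀ i →
  level (deletion F) i ≤ level (link F) i
deletion≤link {m} {F} up i = countᵇ-mono _ _ add-first (allSubsets m)
  where
  add-first : ∀ S → T ((∣ S ∣ ≡ᵇ i) ∧ deletion F S) → T ((∣ S ∣ ≡ᵇ i) ∧ link F S)
  add-first S with ∣ S ∣ ≡ᵇ i
  ... | true  = up (out⊆ ⊆-refl)
  ... | false = id

-- The arithmetic combining the link and deletion inequalities, with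
-- t = link part at level i, a = deletion at level i, and primes for i + 1.
combine-levels : ∀ {t a t′ a′} k i → t * suc k ≤ t′ * i → a * k ≤ a′ * suc i → a ≤ t′ →
  (t + a) * suc k ≤ (t′ + a′) * suc i
combine-levels {t} {a} {t′} {a′} k i link-ineq deletion-ineq a≤t′ = begin
    (t + a) * suc k
  ≡⟨ expand-left t a k ⟩
    t * suc k + (a + a * k)
  ≤⟨ +-mono-≤ link-ineq (+-mono-≤ a≤t′ deletion-ineq) ⟩
    t′ * i + (t′ + a′ * suc i)
  ≡⟨ collect-right t′ a′ i ⟩
    (t′ + a′) * suc i ∎
  where
  open ≤-Reasoning
  expand-left : ∀ t a k → (t + a) * suc k ≡ t * suc k + (a + a * k)
  expand-left = solve-∀
  collect-right : ∀ t′ a′ i → t′ * i + (t′ + a′ * suc i) ≡ (t′ + a′) * suc i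
  collect-right = solve-∀

local-LYM : ∀ n {F : Subset n → Bool} → UpClosed F → ∀ i k → i + k ≡ n →
  level F i * k ≤ level F (suc i) * suc i
local-LYM n {F} up i zero _ rewrite *-zeroʳ (level F i) = z≤n
local-LYM zero up i (suc k) i+k≡0 with () ← trans (sym (+-suc i k)) i+k≡0
local-LYM (suc m) {F} up i (suc k) i+k≡n
  rewrite level-split F i | level-split F (suc i) =
  combine-levels {linkLevel F i} {level (deletion F) i} {linkLevel F (suc i)}
    {level (deletion F) (suc i)} k i (link-ineq i i+k≡n)
    (local-LYM m (deletion-upClosed up) i k (suc-injective
      (trans (sym (+-suc i k)) i+k≡n)))
    (deletion≤link up i)
  where
  link-ineq : ∀ i → i + suc k ≡ suc m → linkLevel F i * suc k ≤ linkLevel F (suc i) * i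
  link-ineq zero    _   = z≤n
  link-ineq (suc j) eq = local-LYM m (link-upClosed up) j (suc k) (suc-injective eq)

∨-mono : ∀ {a a′ b b′} → (T a → T a′) → (T b → T b′) → T (a ∨ b) → T (a′ ∨ b′)
∨-mono {a} {a′} fa fb =
  Equivalence.from (T-∨ {a′}) ∘ Sum.map fa fb ∘ Equivalence.to (T-∨ {a})

∧-mono : ∀ {a a′ b b′} → (T a → T a′) → (T b → T b′) → T (a ∧ b) → T (a′ ∧ b′)
∧-mono {a} {a′} fa fb =
  Equivalence.from (T-∧ {a′}) ∘ Product.map fa fb ∘ Equivalence.to (T-∧ {a})

any-mono : {A : Set} (f g : A → Bool) → (∀ x → T (f x) → T (g x)) →
  ∀ xs → T (any f xs) → T (any g xs)
any-mono f g f⇒g xs = any⁺ g ∘ Any.map (f⇒g _) ∘ any⁻ f xs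

all-mono : {A : Set} (f g : A → Bool) → (∀ x → T (f x) → T (g x)) →
  ∀ xs → T (all f xs) → T (all g xs)
all-mono f g f⇒g xs = all⁻ g ∘ All.map (f⇒g _) ∘ all⁺ f xs

lookup-mono : {n : ℕ} {S S′ : Subset n} → S ⊆ S′ → ∀ v → T (lookup S v) → T (lookup S′ v)
lookup-mono {S = S} S⊆S′ v =
  Equivalence.from T-≡ ∘ []=⇒lookup ∘ S⊆S′ ∘ lookup⇒[]= v S ∘ Equivalence.to T-≡

tabulate-⊆ : {n : ℕ} (F F′ : Fin n → Bool) → (∀ v → T (F v) → T (F′ v)) →
  tabulate F ⊆ tabulate F′
tabulate-⊆ F F′ F⇒F′ {v} =
  lookup⇒[]= v (tabulate F′) ∘ trans (lookup∘tabulate F′ v) ∘ Equivalence.to T-≡ ∘ F⇒F′ v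
  ∘ Equivalence.from T-≡ ∘ trans (sym (lookup∘tabulate F v)) ∘ []=⇒lookup

module _ {n : ℕ} (G : Graph n) where

  dominate-mono : ∀ {S S′} → S ⊆ S′ → dominate G S ⊆ dominate G S′
  dominate-mono S⊆S′ = tabulate-⊆ _ _ λ v →
    ∨-mono (lookup-mono S⊆S′ v)
      (any-mono _ _ (λ u → ∧-mono (lookup-mono S⊆S′ u) id) (allFin n))

  -- Colouring more vertices can only enable more forces: a vertex that is
  -- the unique uncoloured neighbour stays so or becomes coloured itself.
  force-mono : ∀ {C C′} → C ⊆ C′ → force G C ⊆ force G C′
  force-mono C⊆C′ = tabulate-⊆ _ _ λ v →
    ∨-mono (lookup-mono C⊆C′ v)
      (any-mono _ _ (λ u → ∧-mono (lookup-mono C⊆C′ u) (∧-mono id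
        (all-mono _ _ (λ w → ∨-mono (id {A = T (does (w ≟ v))})
          (∨-mono (id {A = T (not (adj G u w))}) (lookup-mono C⊆C′ w))) (allFin n))))
        (allFin n))

  iterate-mono : ∀ k {C C′} → C ⊆ C′ → iterate G k C ⊆ iterate G k C′
  iterate-mono zero    C⊆C′ = C⊆C′
  iterate-mono (suc k) C⊆C′ = iterate-mono k (force-mono C⊆C′)

  powerDominating-upClosed : UpClosed (isPowerDominating G)
  powerDominating-upClosed S⊆S′ =
    all-mono _ _ (lookup-mono (iterate-mono n (dominate-mono S⊆S′))) (allFin n)

below-middle : ∀ {n i} → 2 * i < n → ∃ λ k → i + k ≡ n × suc i ≤ k
below-middle {n} {i} 2i<n with m≤n⇒∃[o]m+o≡n 2i<n
... | o , 1+2i+o≡n = suc i + o , trans (rearrange i o) 1+2i+o≡n , m≤m+n (suc i) o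
  where
  rearrange : ∀ i o → i + (suc i + o) ≡ suc (2 * i) + o
  rearrange = solve-∀

-- p G is the level function of the up-closed family of power dominating
-- sets; the local LYM inequality with n − i ≥ i + 1 lets us cancel i + 1.
proposition5 : (n : ℕ) → (G : Graph n) → (i : ℕ) → 1 ≤ i → 2 * i < n →
    p G i ≤ p G (suc i)
proposition5 n G i _ 2i<n with below-middle 2i<n
... | k , i+k≡n , 1+i≤k = *-cancelʳ-≤ (p G i) (p G (suc i)) (suc i)
  (≤-trans (*-monoʳ-≤ (p G i) 1+i≤k)
           (local-LYM n (powerDominating-upClosed G) i k i+k≡n))
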